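{- Let $\lambda,\mu$ be partitions with at most $n$ parts with $\mu\subseteq\lambda$, and let $r,s\in\mathbb Z_{>0}^n$ with $r_i\le s_i$ for all $i$, such that $r_i\le r_{i+1}$ and $s_i\le s_{i+1}$ for each $1\le i\le n-1$ with $\mu_i<\lambda_{i+1}$. Then \begin{multline*} \det\Big(\chi(r_j\le s_i)\,e_{\lambda_i-\mu_j-i+j}\big[X_{[r_j,s_i]}-A_{i-1}+A_{j-1}+B_{\lambda_i-1}-B_{\mu_j}\big]\Big)_{i,j=1}^n\\ =\det\Big(e_{\lambda_i-\mu_j-i+j}\big[X_{[r_j,s_i]}-A_{i-1}+A_{j-1}+B_{\lambda_i-1}-B_{\mu_j}\big]\Big)_{i,j=1}^n. \end{multline*}
   Context: $\chi(p)$ is $1$ if the statement $p$ is true and $0$ otherwise. Indeterminates $x=(x_i)$, $\alpha=(\alpha_i)$, $\beta=(\beta_i)$; $A_m=\alpha_1+\dots+\alpha_m$, $B_m=\beta_1+\dots+\beta_m$ ($=0$ for $m\le0$); $X_{[r,s]}=x_r+\dots+x_s$ ($=0$ if $r>s$). For a formal $\mathbb Z$-linear combination $Z=\sum_vc_vv$ of finitely many indeterminates, $e_m[Z]$ is the coefficient of $t^m$ in $\prod_v(1+vt)^{c_v}$ ($0$ for $m<0$). Partitions are padded with zeros. -}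

module Defs where

open import Level using (Level)
open import Algebra.Bundles using (CommutativeRing)
open import Data.Nat using (ℕ; zero; suc; _∸_; _≤ᵇ_)
import Data.Nat as N
open import Data.Nat.Base using (_%_)
open import Data.Integer using (ℤ; +_; -[1+_])
import Data.Integer as Int
open import Data.Fin using (Fin; zero; suc; toℕ; punchIn)
open import Data.List using (List; []; _∷_; _++_; map; upTo; foldr)
open import Data.Product using (_×_; _,_)
open import Data.Bool using (if_then_else_)

data Sgn : Set where
  plus minus : Sgn

range : ℕ → ℕ → List ℕ
range a b = map (λ k → a N.+ k) (upTo (suc b ∸ a))

module _ {c ℓ : Level} (R : CommutativeRing c ℓ) where
  open CommutativeRing R using (Carrier; _+_; _*_; -_; 0#; 1#)

  -- A formal ℤ-linear combination of indeterminates, given as a list of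
  -- signed (evaluated) indeterminates: (plus , v) stands for +v, (minus , v) for -v.
  Comb : Set c
  Comb = List (Sgn × Carrier)

  pow : Carrier → ℕ → Carrier
  pow v zero = 1#
  pow v (suc k) = v * pow v k

  sumL : List Carrier → Carrier
  sumL = foldr _+_ 0#

  -- eN m Z = coefficient of t^m in ∏_v (1 + v t)^{c_v}, where
  -- (1 + v t)^{-1} = Σ_k (-v)^k t^k as a formal power series.
  eN : ℕ → Comb → Carrier
  eN zero [] = 1#
  eN (suc m) [] = 0#
  eN zero ((plus , v) ∷ Z) = eN zero Z
  eN (suc m) ((plus , v) ∷ Z) = eN (suc m) Z + v * eN m Z
  eN m ((minus , v) ∷ Z) = sumL (map (λ k → pow (- v) k * eN (m ∸ k) Z) (upTo (suc m)))

  e : ℤ → Comb → Carrier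
  e (+ m) Z = eN m Z
  e -[1+ _ ] Z = 0#

  pos neg : List Carrier → Comb
  pos = map (λ v → (plus , v))
  neg = map (λ v → (minus , v))

  Xr : (ℕ → Carrier) → ℕ → ℕ → List Carrier
  Xr x a b = map x (range a b)

  Sm : (ℕ → Carrier) → ℕ → List Carrier
  Sm α m = map α (range 1 m)

  sumFin : ∀ n → (Fin n → Carrier) → Carrier
  sumFin zero f = 0#
  sumFin (suc n) f = f zero + sumFin n (λ j → f (suc j))

  signN : ℕ → Carrier
  signN k = if (k % 2 N.≡ᵇ 0) then 1# else - 1#

  det : ∀ n → (Fin n → Fin n → Carrier) → Carrier
  det zero M = 1#
  det (suc n) M = sumFin (suc n) (λ j →
    signN (toℕ j) * (M zero j * det n (λ a b → M (suc a) (punchIn j b))))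

  entry : (x α β : ℕ → Carrier) (lam mu r s : ℕ → ℕ) → ℕ → ℕ → Carrier
  entry x α β lam mu r s I J =
    e ((((+ lam I) Int.- (+ mu J)) Int.- (+ I)) Int.+ (+ J))
      (pos (Xr x (r J) (s I)) ++ neg (Sm α (I ∸ 1)) ++ pos (Sm α (J ∸ 1))
        ++ pos (Sm β (lam I ∸ 1)) ++ neg (Sm β (mu J)))

  entryχ : (x α β : ℕ → Carrier) (lam mu r s : ℕ → ℕ) → ℕ → ℕ → Carrier
  entryχ x α β lam mu r s I J =
    if r J ≤ᵇ s I then entry x α β lam mu r s I J else 0#

{-# OPTIONS --safe #-}
-- The two matrices differ only at entries (I, J) with s_I < r_J; as r_I ≤ s_I, I ≠ J there.
-- If I > J, r cannot increase from J to I, so λ/μ splits (λ_{k+1} ≤ μ_k) at some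
-- J ≤ k < I; below and left of such a split every entry has negative degree, so both
-- matrices vanish at (I, J). If I < J and λ/μ splits at J − 1, then (I, J) lies above a
-- zero corner shared by both matrices and cannot affect either determinant. Otherwise
-- μ_J < λ_I and X_[r_J,s_I] is empty, and the alphabet telescopes to
-- α_I, …, α_{J−1}, β_{μ_J+1}, …, β_{λ_I−1}: fewer letters than the degree
-- λ_I − μ_J − I + J, so the entry is zero anyway.
module Submission where

open import Defs
open import Level using (Level)
open import Algebra.Bundles using (CommutativeRing)
open import Data.Nat as ℕ
  using (ℕ; zero; suc; _∸_; _≤_; _<_; _≤′_; _≤?_; _<?_; _≤ᵇ_; z≤n; s≤s; pred; ≤′-refl; ≤′-step)
open import Data.Fin using (Fin; zero; suc; toℕ; punchIn)
open import Data.Product using (_×_; _,_; proj₁; ∃-syntax)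
open import Data.Nat.Properties
  using (≤-refl; ≤-reflexive; ≤-trans; <⇒≤; ≤-<-trans; <-≤-trans; ≤-pred; <-cmp;
         <⇒≱; ≮⇒≥; ≰⇒>; ≤⇒≤′; ≤′⇒≤; m+[n∸m]≡n; m<n⇒m<1+n; +-mono-≤-<; m≤m+n;
         m+n∸m≡n; m≤n⇒m∸n≡0; ≤ᵇ-reflects-≤; module ≤-Reasoning)
open import Data.Nat.Tactic.RingSolver as ℕ-Solver using ()
open import Data.Integer as ℤ using (+_; -[1+_]; _⊖_; sign)
open import Data.Integer.Properties using (pos-+; [+m]-[+n]≡m⊖n; ≤-⊖; sign-⊖-<)
open import Data.Integer.Tactic.RingSolver as ℤ-Solver using ()
open import Data.Sign using (Sign)
open import Data.Fin.Properties using (toℕ<n; toℕ≤pred[n])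
open import Data.List using (List; []; _∷_; _++_; map; upTo; applyUpTo; length)
open import Data.List.Properties using (map-++; ++-identityʳ; length-++; length-applyUpTo; map-upTo; map-applyUpTo)
open import Data.Sum using (_⊎_; inj₁; inj₂)
open import Data.Empty using (⊥-elim)
open import Data.Bool using (true; false)
open import Function using (_∘_)
open import Relation.Binary.Bundles using (Setoid)
open import Relation.Binary.Definitions using (tri<; tri≈; tri>)
import Relation.Binary.PropositionalEquality as ≡
open ≡ using (_≡_)
import Relation.Binary.Reasoning.Setoid as SetoidReasoning
open import Relation.Nullary using (¬_; yes; no)
open import Relation.Nullary.Reflects using (ofʸ; ofⁿ)

pred[m]≤n⇒m≤1+n : ∀ {m n} → pred m ≤ n → m ≤ suc n
pred[m]≤n⇒m≤1+n {zero} _ = z≤n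
pred[m]≤n⇒m≤1+n {suc m} m≤n = s≤s m≤n

stepwise-antitone : ∀ {n} (f : ℕ → ℕ) → (∀ i → 1 ≤ i → i < n → f (suc i) ≤ f i) →
           ∀ {a b} → 1 ≤ a → a ≤ b → b ≤ n → f b ≤ f a
stepwise-antitone {n} f step {a} 1≤a a≤b = go (≤⇒≤′ a≤b)
  where
  go : ∀ {b} → a ≤′ b → b ≤ n → f b ≤ f a
  go ≤′-refl _ = ≤-refl
  go (≤′-step {b} a≤′b) b<n =
    ≤-trans (step b (≤-trans 1≤a (≤′⇒≤ a≤′b)) b<n) (go a≤′b (<⇒≤ b<n))

toℕ-punchIn-≤ : ∀ {n} (j : Fin (suc n)) (b : Fin n) → toℕ (punchIn j b) ≤ suc (toℕ b)
toℕ-punchIn-≤ zero b = ≤-refl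
toℕ-punchIn-≤ (suc j) zero = z≤n
toℕ-punchIn-≤ (suc j) (suc b) = s≤s (toℕ-punchIn-≤ j b)

toℕ-punchIn-< : ∀ {n} (j : Fin (suc n)) (b : Fin n) → toℕ b < toℕ j → toℕ (punchIn j b) ≡ toℕ b
toℕ-punchIn-< (suc j) zero _ = ≡.refl
toℕ-punchIn-< (suc j) (suc b) (s≤s b<j) = ≡.cong suc (toℕ-punchIn-< j b b<j)

applyUpTo-+ : ∀ {a} {A : Set a} (f : ℕ → A) p q →
              applyUpTo f (p ℕ.+ q) ≡ applyUpTo f p ++ applyUpTo (f ∘ (p ℕ.+_)) q
applyUpTo-+ f zero q = ≡.refl
applyUpTo-+ f (suc p) q = ≡.cong (f 0 ∷_) (applyUpTo-+ (f ∘ ℕ.suc) p q)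

module Determinant {c ℓ : Level} (R : CommutativeRing c ℓ) where
  open CommutativeRing R hiding (zero)

  Matrix : ℕ → Set c
  Matrix n = Fin n → Fin n → Carrier

  minor : ∀ {n} → Matrix (suc n) → Fin (suc n) → Matrix n
  minor M j a b = M (suc a) (punchIn j b)

  laplaceTerm : ∀ {n} → Matrix (suc n) → Fin (suc n) → Carrier
  laplaceTerm {n} M j = signN R (toℕ j) * (M zero j * det R n (minor M j))

  ZeroBlock : ∀ {n} → Matrix n → ℕ → ℕ → Set ℓ
  ZeroBlock M p q = ∀ a b → p ≤ toℕ a → toℕ b < q → M a b ≈ 0#

  sumFin-cong : ∀ {n} {f g : Fin n → Carrier} → (∀ j → f j ≈ g j) → sumFin R n f ≈ sumFin R n g
  sumFin-cong {zero} _ = refl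
  sumFin-cong {suc n} f≈g = +-cong (f≈g zero) (sumFin-cong (f≈g ∘ suc))

  sumFin-zero : ∀ {n} {f : Fin n → Carrier} → (∀ j → f j ≈ 0#) → sumFin R n f ≈ 0#
  sumFin-zero {zero} _ = refl
  sumFin-zero {suc n} f≈0 = trans (+-cong (f≈0 zero) (sumFin-zero (f≈0 ∘ suc))) (+-identityʳ 0#)

  laplaceTerm-zeroˡ : ∀ {n} (M : Matrix (suc n)) j → M zero j ≈ 0# → laplaceTerm M j ≈ 0#
  laplaceTerm-zeroˡ M j M₀ⱼ≈0 = trans (*-congˡ (trans (*-congʳ M₀ⱼ≈0) (zeroˡ _))) (zeroʳ _)

  laplaceTerm-zeroʳ : ∀ {n} (M : Matrix (suc n)) j → det R n (minor M j) ≈ 0# → laplaceTerm M j ≈ 0#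
  laplaceTerm-zeroʳ M j det≈0 = trans (*-congˡ (trans (*-congˡ det≈0) (zeroʳ _))) (zeroʳ _)

  minor-zeroBlock-suc : ∀ {n} {M : Matrix (suc n)} {p q} j →
                        ZeroBlock M p (suc q) → ZeroBlock (minor M j) (pred p) q
  minor-zeroBlock-suc j Z a b p≤a b<q =
    Z (suc a) (punchIn j b) (pred[m]≤n⇒m≤1+n p≤a) (≤-<-trans (toℕ-punchIn-≤ j b) (s≤s b<q))

  minor-zeroBlock-≤ : ∀ {n} {M : Matrix (suc n)} {p q} j → q ≤ toℕ j →
                      ZeroBlock M p q → ZeroBlock (minor M j) (pred p) q
  minor-zeroBlock-≤ j q≤j Z a b p≤a b<q =
    Z (suc a) (punchIn j b) (pred[m]≤n⇒m≤1+n p≤a)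
      (≡.subst (_< _) (≡.sym (toℕ-punchIn-< j b (<-≤-trans b<q q≤j))) b<q)

  -- Rows p, …, n − 1 are supported on the fewer columns q, …, n − 1.
  det-zeroBlock : ∀ {n} (M : Matrix n) {p q} → p < q → q ≤ n → ZeroBlock M p q → det R n M ≈ 0#
  det-zeroBlock {zero} _ () z≤n _
  det-zeroBlock {suc n} M {zero} {q} 0<q q≤1+n Z = sumFin-zero term
    where
    term : ∀ j → laplaceTerm M j ≈ 0#
    term j with q ≤? toℕ j
    ... | yes q≤j = laplaceTerm-zeroʳ M j
          (det-zeroBlock (minor M j) 0<q (≤-trans q≤j (toℕ≤pred[n] j)) (minor-zeroBlock-≤ j q≤j Z))
    ... | no q≰j = laplaceTerm-zeroˡ M j (Z zero j z≤n (≰⇒> q≰j))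
  det-zeroBlock {suc n} M {suc p} {suc q} (s≤s p<q) (s≤s q≤n) Z = sumFin-zero term
    where
    term : ∀ j → laplaceTerm M j ≈ 0#
    term j with suc q ≤? toℕ j
    ... | yes q<j = laplaceTerm-zeroʳ M j
          (det-zeroBlock (minor M j) (m<n⇒m<1+n p<q) (≤-trans q<j (toℕ≤pred[n] j))
            (minor-zeroBlock-≤ j q<j Z))
    ... | no _ = laplaceTerm-zeroʳ M j (det-zeroBlock (minor M j) p<q q≤n (minor-zeroBlock-suc j Z))

  -- Entries of M and M′ may differ where they lie above a common zero corner: there both
  -- matrices are block triangular, and their determinants only see the diagonal blocks.
  AgreeOrOffDiagonal : ∀ {n} → Matrix n → Matrix n → Fin n → Fin n → Set ℓ
  AgreeOrOffDiagonal M M′ i j =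
    M i j ≈ M′ i j ⊎ ∃[ k ] (toℕ i < k × k ≤ toℕ j × ZeroBlock M k k × ZeroBlock M′ k k)

  minor-agreeOrOffDiagonal : ∀ {n} {M M′ : Matrix (suc n)} j a b →
    AgreeOrOffDiagonal M M′ (suc a) (punchIn j b) → AgreeOrOffDiagonal (minor M j) (minor M′ j) a b
  minor-agreeOrOffDiagonal j a b (inj₁ Mab≈M′ab) = inj₁ Mab≈M′ab
  minor-agreeOrOffDiagonal j a b (inj₂ (suc k , s≤s a<k , k≤j , Z , Z′)) =
    inj₂ (k , a<k , ≤-pred (≤-trans k≤j (toℕ-punchIn-≤ j b)) ,
          minor-zeroBlock-suc j Z , minor-zeroBlock-suc j Z′)

  det-cong-offDiagonal : ∀ {n} {M M′ : Matrix n} → (∀ i j → AgreeOrOffDiagonal M M′ i j) →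
                         det R n M ≈ det R n M′
  det-cong-offDiagonal {zero} _ = refl
  det-cong-offDiagonal {suc n} {M} {M′} agree = sumFin-cong term
    where
    term : ∀ j → laplaceTerm M j ≈ laplaceTerm M′ j
    term j with agree zero j
    ... | inj₁ M₀ⱼ≈M′₀ⱼ = *-congˡ (*-cong M₀ⱼ≈M′₀ⱼ (det-cong-offDiagonal (λ a b →
            minor-agreeOrOffDiagonal j a b (agree (suc a) (punchIn j b)))))
    ... | inj₂ (suc k , _ , k<j , Z , Z′) = trans (vanishes M Z) (sym (vanishes M′ Z′))
      where
      vanishes : ∀ N → ZeroBlock N (suc k) (suc k) → laplaceTerm N j ≈ 0#
      vanishes N Z = laplaceTerm-zeroʳ N j
        (det-zeroBlock (minor N j) ≤-refl (≤-trans k<j (toℕ≤pred[n] j)) (minor-zeroBlock-≤ j k<j Z))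

module GeneratingSeries {c ℓ : Level} (R : CommutativeRing c ℓ) where
  open CommutativeRing R hiding (zero)
  open import Algebra.Solver.Ring.NaturalCoefficients.Default commutativeSemiring using (solve; _:+_; _:*_; _:=_)

  Seq : Set c
  Seq = ℕ → Carrier

  infix 4 _≐_
  _≐_ : Seq → Seq → Set ℓ
  f ≐ g = ∀ m → f m ≈ g m

  ≐-setoid : Setoid c ℓ
  ≐-setoid = record
    { Carrier = Seq
    ; _≈_ = _≐_
    ; isEquivalence = record
      { refl = λ _ → refl
      ; sym = λ f≐g m → sym (f≐g m)
      ; trans = λ f≐g g≐h m → trans (f≐g m) (g≐h m)
      }
    }

  module ≐-Reasoning = SetoidReasoning ≐-setoid

  -- The coefficient sequences of (1 + v t) f(t) and of f(t) / (1 + v t).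
  mul1+ : Carrier → Seq → Seq
  mul1+ v f zero = f zero
  mul1+ v f (suc m) = f (suc m) + v * f m

  div1+ : Carrier → Seq → Seq
  div1+ v f m = sumL R (applyUpTo (λ k → pow R (- v) k * f (m ∸ k)) (suc m))

  E : Comb R → Seq
  E Z m = eN R m Z

  E-plus : ∀ v Z → E ((plus , v) ∷ Z) ≐ mul1+ v (E Z)
  E-plus v Z zero = refl
  E-plus v Z (suc m) = refl

  E-minus : ∀ v Z → E ((minus , v) ∷ Z) ≐ div1+ v (E Z)
  E-minus v Z zero = refl
  E-minus v Z (suc m) = reflexive (≡.cong (sumL R) (map-upTo _ (suc (suc m))))

  sumL-applyUpTo-*ˡ : ∀ a {F G : ℕ → Carrier} n → (∀ k → F k ≈ a * G k) →
                      sumL R (applyUpTo F n) ≈ a * sumL R (applyUpTo G n)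
  sumL-applyUpTo-*ˡ a zero _ = sym (zeroʳ a)
  sumL-applyUpTo-*ˡ a (suc n) F≈aG =
    trans (+-cong (F≈aG 0) (sumL-applyUpTo-*ˡ a n (F≈aG ∘ suc))) (sym (distribˡ a _ _))

  div1+-zero : ∀ v f → div1+ v f 0 ≈ f 0
  div1+-zero v f = trans (+-identityʳ _) (*-identityˡ _)

  div1+-suc : ∀ v f m → div1+ v f (suc m) ≈ f (suc m) + - v * div1+ v f m
  div1+-suc v f m = +-cong (*-identityˡ _)
    (sumL-applyUpTo-*ˡ (- v) (suc m) (λ k → *-assoc (- v) (pow R (- v) k) (f (m ∸ k))))

  div1+-unique : ∀ v f h → h 0 ≈ f 0 → (∀ m → h (suc m) ≈ f (suc m) + - v * h m) → h ≐ div1+ v f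
  div1+-unique v f h h₀ hₛ zero = trans h₀ (sym (div1+-zero v f))
  div1+-unique v f h h₀ hₛ (suc m) =
    trans (hₛ m) (trans (+-congˡ (*-congˡ (div1+-unique v f h h₀ hₛ m))) (sym (div1+-suc v f m)))

  mul1+-cong : ∀ v {f g} → f ≐ g → mul1+ v f ≐ mul1+ v g
  mul1+-cong v f≐g zero = f≐g zero
  mul1+-cong v f≐g (suc m) = +-cong (f≐g (suc m)) (*-congˡ (f≐g m))

  div1+-cong : ∀ v {f g} → f ≐ g → div1+ v f ≐ div1+ v g
  div1+-cong v {f} {g} f≐g = div1+-unique v g (div1+ v f)
    (trans (div1+-zero v f) (f≐g 0)) (λ m → trans (div1+-suc v f m) (+-congʳ (f≐g (suc m))))

  div1+-mul1+ : ∀ v f → div1+ v (mul1+ v f) ≐ f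
  div1+-mul1+ v f m = sym (div1+-unique v (mul1+ v f) f refl (λ m → sym (cancel (f (suc m)) (f m))) m)
    where
    cancel : ∀ a b → (a + v * b) + - v * b ≈ a
    cancel a b = begin
      (a + v * b) + - v * b   ≈⟨ +-assoc a _ _ ⟩
      a + (v * b + - v * b)   ≈⟨ +-congˡ (distribʳ b v (- v)) ⟨
      a + (v + - v) * b       ≈⟨ +-congˡ (trans (*-congʳ (-‿inverseʳ v)) (zeroˡ b)) ⟩
      a + 0#                  ≈⟨ +-identityʳ a ⟩
      a                       ∎
      where open SetoidReasoning setoid

  mul1+-div1+ : ∀ a b f → mul1+ a (div1+ b f) ≐ div1+ b (mul1+ a f)
  mul1+-div1+ a b f = div1+-unique b (mul1+ a f) (mul1+ a D) (div1+-zero b f) step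
    where
    D : Seq
    D = div1+ b f
    step : ∀ m → mul1+ a D (suc m) ≈ mul1+ a f (suc m) + - b * mul1+ a D m
    step zero = trans (+-cong (div1+-suc b f 0) (*-congˡ (div1+-zero b f)))
      (solve 5 (λ f₁ D₀ f₀ a b → (f₁ :+ b :* D₀) :+ a :* f₀ := (f₁ :+ a :* f₀) :+ b :* D₀)
        refl (f 1) (D 0) (f 0) a (- b))
    step (suc m) = trans (+-cong (div1+-suc b f (suc m)) (*-congˡ (div1+-suc b f m)))
      (solve 6 (λ f₂ f₁ D₁ D₀ a b →
          (f₂ :+ b :* D₁) :+ a :* (f₁ :+ b :* D₀) := (f₂ :+ a :* f₁) :+ b :* (D₁ :+ a :* D₀))
        refl (f (suc (suc m))) (f (suc m)) (D (suc m)) (D m) a (- b))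

  ∷-cong : ∀ σv {Z W} → E Z ≐ E W → E (σv ∷ Z) ≐ E (σv ∷ W)
  ∷-cong (plus , v) {Z} {W} Z≐W = begin
    E ((plus , v) ∷ Z)   ≈⟨ E-plus v Z ⟩
    mul1+ v (E Z)        ≈⟨ mul1+-cong v Z≐W ⟩
    mul1+ v (E W)        ≈⟨ E-plus v W ⟨
    E ((plus , v) ∷ W)   ∎
    where open ≐-Reasoning
  ∷-cong (minus , v) {Z} {W} Z≐W = begin
    E ((minus , v) ∷ Z)  ≈⟨ E-minus v Z ⟩
    div1+ v (E Z)        ≈⟨ div1+-cong v Z≐W ⟩
    div1+ v (E W)        ≈⟨ E-minus v W ⟨
    E ((minus , v) ∷ W)  ∎
    where open ≐-Reasoning

  ++-congˡ : ∀ P {Z W} → E Z ≐ E W → E (P ++ Z) ≐ E (P ++ W)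
  ++-congˡ [] Z≐W = Z≐W
  ++-congˡ (σv ∷ P) Z≐W = ∷-cong σv (++-congˡ P Z≐W)

  minus-plus-comm : ∀ u v Z → E ((minus , u) ∷ (plus , v) ∷ Z) ≐ E ((plus , v) ∷ (minus , u) ∷ Z)
  minus-plus-comm u v Z = begin
    E ((minus , u) ∷ (plus , v) ∷ Z)  ≈⟨ E-minus u _ ⟩
    div1+ u (E ((plus , v) ∷ Z))      ≈⟨ div1+-cong u (E-plus v Z) ⟩
    div1+ u (mul1+ v (E Z))           ≈⟨ mul1+-div1+ v u (E Z) ⟨
    mul1+ v (div1+ u (E Z))           ≈⟨ mul1+-cong v (E-minus u Z) ⟨
    mul1+ v (E ((minus , u) ∷ Z))     ≈⟨ E-plus v _ ⟨
    E ((plus , v) ∷ (minus , u) ∷ Z)  ∎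
    where open ≐-Reasoning

  minus-plus-cancel : ∀ v Z → E ((minus , v) ∷ (plus , v) ∷ Z) ≐ E Z
  minus-plus-cancel v Z = begin
    E ((minus , v) ∷ (plus , v) ∷ Z)  ≈⟨ E-minus v _ ⟩
    div1+ v (E ((plus , v) ∷ Z))      ≈⟨ div1+-cong v (E-plus v Z) ⟩
    div1+ v (mul1+ v (E Z))           ≈⟨ div1+-mul1+ v (E Z) ⟩
    E Z                               ∎
    where open ≐-Reasoning

  neg-plus-comm : ∀ L v Z → E (neg R L ++ (plus , v) ∷ Z) ≐ E ((plus , v) ∷ neg R L ++ Z)
  neg-plus-comm [] v Z _ = refl
  neg-plus-comm (u ∷ L) v Z = begin
    E ((minus , u) ∷ neg R L ++ (plus , v) ∷ Z)  ≈⟨ ∷-cong (minus , u) (neg-plus-comm L v Z) ⟩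
    E ((minus , u) ∷ (plus , v) ∷ neg R L ++ Z)  ≈⟨ minus-plus-comm u v _ ⟩
    E ((plus , v) ∷ (minus , u) ∷ neg R L ++ Z)  ∎
    where open ≐-Reasoning

  neg-pos-comm : ∀ N P → E (neg R N ++ pos R P) ≐ E (pos R P ++ neg R N)
  neg-pos-comm N [] m = reflexive (≡.cong (eN R m) (++-identityʳ (neg R N)))
  neg-pos-comm N (v ∷ P) = begin
    E (neg R N ++ (plus , v) ∷ pos R P)  ≈⟨ neg-plus-comm N v (pos R P) ⟩
    E ((plus , v) ∷ neg R N ++ pos R P)  ≈⟨ ∷-cong (plus , v) (neg-pos-comm N P) ⟩
    E ((plus , v) ∷ pos R P ++ neg R N)  ∎
    where open ≐-Reasoning

  neg-pos-cancel : ∀ L L′ Z → E (neg R L ++ pos R (L ++ L′) ++ Z) ≐ E (pos R L′ ++ Z)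
  neg-pos-cancel [] L′ Z _ = refl
  neg-pos-cancel (v ∷ L) L′ Z = begin
    E ((minus , v) ∷ neg R L ++ (plus , v) ∷ pos R (L ++ L′) ++ Z)
      ≈⟨ ∷-cong (minus , v) (neg-plus-comm L v _) ⟩
    E ((minus , v) ∷ (plus , v) ∷ neg R L ++ pos R (L ++ L′) ++ Z)
      ≈⟨ minus-plus-cancel v _ ⟩
    E (neg R L ++ pos R (L ++ L′) ++ Z)
      ≈⟨ neg-pos-cancel L L′ Z ⟩
    E (pos R L′ ++ Z)
      ∎
    where open ≐-Reasoning

  eN-pos-vanishes : ∀ L {m} → length L < m → eN R m (pos R L) ≈ 0#
  eN-pos-vanishes [] {suc m} _ = refl
  eN-pos-vanishes (v ∷ L) {suc m} (s≤s |L|<m) =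
    trans (+-cong (eN-pos-vanishes L (m<n⇒m<1+n |L|<m)) (*-congˡ (eN-pos-vanishes L |L|<m)))
          (trans (+-identityˡ _) (zeroʳ v))

  eN-telescoping-vanishes : ∀ A A′ B B′ {m} → length A′ ℕ.+ length B′ < m →
    eN R m (neg R A ++ pos R (A ++ A′) ++ pos R (B ++ B′) ++ neg R B) ≈ 0#
  eN-telescoping-vanishes A A′ B B′ {m} lt =
    trans (telescope m) (eN-pos-vanishes (A′ ++ B′) (≡.subst (_< m) (≡.sym (length-++ A′)) lt))
    where
    open ≐-Reasoning
    trailing : E (pos R (B ++ B′) ++ neg R B) ≐ E (pos R B′)
    trailing = begin
      E (pos R (B ++ B′) ++ neg R B)        ≈⟨ neg-pos-comm B (B ++ B′) ⟨
      E (neg R B ++ pos R (B ++ B′))        ≡⟨ ≡.cong (λ W → E (neg R B ++ W)) (++-identityʳ _) ⟨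
      E (neg R B ++ pos R (B ++ B′) ++ [])  ≈⟨ neg-pos-cancel B B′ [] ⟩
      E (pos R B′ ++ [])                    ≡⟨ ≡.cong E (++-identityʳ _) ⟩
      E (pos R B′)                          ∎
    telescope : E (neg R A ++ pos R (A ++ A′) ++ pos R (B ++ B′) ++ neg R B) ≐ E (pos R (A′ ++ B′))
    telescope = begin
      E (neg R A ++ pos R (A ++ A′) ++ pos R (B ++ B′) ++ neg R B)  ≈⟨ neg-pos-cancel A A′ _ ⟩
      E (pos R A′ ++ pos R (B ++ B′) ++ neg R B)                   ≈⟨ ++-congˡ (pos R A′) trailing ⟩
      E (pos R A′ ++ pos R B′)                                     ≡⟨ ≡.cong E (map-++ _ A′ B′) ⟨
      E (pos R (A′ ++ B′))                                         ∎

degree≡⊖ : ∀ L M I J → ((+ L ℤ.- + M) ℤ.- + I) ℤ.+ + J ≡ (L ℕ.+ J) ⊖ (M ℕ.+ I)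
degree≡⊖ L M I J = begin
  ((+ L ℤ.- + M) ℤ.- + I) ℤ.+ + J        ≡⟨ regroup (+ L) (+ M) (+ I) (+ J) ⟩
  (+ L ℤ.+ + J) ℤ.- (+ M ℤ.+ + I)        ≡⟨ ≡.cong₂ ℤ._-_ (pos-+ L J) (pos-+ M I) ⟨
  + (L ℕ.+ J) ℤ.- + (M ℕ.+ I)            ≡⟨ [+m]-[+n]≡m⊖n (L ℕ.+ J) (M ℕ.+ I) ⟩
  (L ℕ.+ J) ⊖ (M ℕ.+ I)                  ∎
  where
  open ≡.≡-Reasoning
  regroup : ∀ a b c d → ((a ℤ.- b) ℤ.- c) ℤ.+ d ≡ (a ℤ.+ d) ℤ.- (b ℤ.+ c)
  regroup = ℤ-Solver.solve-∀

degree-negative : ∀ {L M I J} → L ℕ.+ J < M ℕ.+ I → sign (((+ L ℤ.- + M) ℤ.- + I) ℤ.+ + J) ≡ Sign.-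
degree-negative {L} {M} {I} {J} lt = ≡.trans (≡.cong sign (degree≡⊖ L M I J)) (sign-⊖-< lt)

degree-≡ : ∀ {L M I J m} → L ℕ.+ J ≡ (M ℕ.+ I) ℕ.+ m → ((+ L ℤ.- + M) ℤ.- + I) ℤ.+ + J ≡ + m
degree-≡ {L} {M} {I} {J} {m} eq = begin
  ((+ L ℤ.- + M) ℤ.- + I) ℤ.+ + J        ≡⟨ degree≡⊖ L M I J ⟩
  (L ℕ.+ J) ⊖ (M ℕ.+ I)                  ≡⟨ ≡.cong (_⊖ (M ℕ.+ I)) eq ⟩
  (M ℕ.+ I ℕ.+ m) ⊖ (M ℕ.+ I)            ≡⟨ ≤-⊖ (m≤m+n (M ℕ.+ I) m) ⟩
  + (M ℕ.+ I ℕ.+ m ∸ (M ℕ.+ I))          ≡⟨ ≡.cong +_ (m+n∸m≡n (M ℕ.+ I) m) ⟩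
  + m                                    ∎
  where open ≡.≡-Reasoning

module EntryVanishing {c ℓ : Level} (R : CommutativeRing c ℓ) (x α β : ℕ → CommutativeRing.Carrier R) where
  open CommutativeRing R hiding (zero)
  open GeneratingSeries R using (eN-telescoping-vanishes)

  Xr-empty : ∀ {a b} → b < a → Xr R x a b ≡ []
  Xr-empty {a} b<a = ≡.cong (λ k → map x (map (a ℕ.+_) (upTo k))) (m≤n⇒m∸n≡0 b<a)

  Sm≡applyUpTo : ∀ f m → Sm R f m ≡ applyUpTo (f ∘ ℕ.suc) m
  Sm≡applyUpTo f m = ≡.trans (≡.cong (map f) (map-upTo ℕ.suc m)) (map-applyUpTo ℕ.suc f m)

  Sm-+ : ∀ f p q → Sm R f (p ℕ.+ q) ≡ Sm R f p ++ applyUpTo (f ∘ ℕ.suc ∘ (p ℕ.+_)) q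
  Sm-+ f p q = begin
    Sm R f (p ℕ.+ q)                        ≡⟨ Sm≡applyUpTo f (p ℕ.+ q) ⟩
    applyUpTo (f ∘ ℕ.suc) (p ℕ.+ q)         ≡⟨ applyUpTo-+ (f ∘ ℕ.suc) p q ⟩
    applyUpTo (f ∘ ℕ.suc) p ++ extension    ≡⟨ ≡.cong (_++ extension) (Sm≡applyUpTo f p) ⟨
    Sm R f p ++ extension                   ∎
    where
    open ≡.≡-Reasoning
    extension : List Carrier
    extension = applyUpTo (f ∘ ℕ.suc ∘ (p ℕ.+_)) q

  e-negative : ∀ {z} Z → sign z ≡ Sign.- → e R z Z ≈ 0#
  e-negative { -[1+ _ ]} _ _ = refl

  private
    balance : ∀ μ q i d → suc (μ ℕ.+ q) ℕ.+ suc (i ℕ.+ d) ≡ (μ ℕ.+ suc i) ℕ.+ suc (d ℕ.+ q)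
    balance = ℕ-Solver.solve-∀

  -- With j = i + d and L = μ + q + 1 the degree is d + q + 1, while the alphabet
  -- telescopes to α_{i+1}, …, α_{i+d}, β_{μ+1}, …, β_{μ+q}.
  e-telescoping-vanishes : ∀ {i j μ L a b} → i ≤ j → μ < L → b < a →
    e R (((+ L ℤ.- + μ) ℤ.- + suc i) ℤ.+ + suc j)
      (pos R (Xr R x a b) ++ neg R (Sm R α i) ++ pos R (Sm R α j)
        ++ pos R (Sm R β (L ∸ 1)) ++ neg R (Sm R β μ)) ≈ 0#
  e-telescoping-vanishes {i} {j} {μ} {L} i≤j μ<L b<a
    with j ∸ i | m+[n∸m]≡n i≤j | L ∸ suc μ | m+[n∸m]≡n μ<L
  ... | d | ≡.refl | q | ≡.refl
    rewrite Xr-empty b<a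
          | degree-≡ {suc (μ ℕ.+ q)} {μ} {suc i} {suc (i ℕ.+ d)} {suc (d ℕ.+ q)} (balance μ q i d)
          | Sm-+ α i d | Sm-+ β μ q =
    eN-telescoping-vanishes (Sm R α i) _ (Sm R β μ) _
      (s≤s (≤-reflexive (≡.cong₂ ℕ._+_ (length-applyUpTo _ d) (length-applyUpTo _ q))))

module Entries {c ℓ : Level} (R : CommutativeRing c ℓ) (x α β : ℕ → CommutativeRing.Carrier R)
    (n : ℕ) (lam mu r s : ℕ → ℕ)
    (lam-antitone : ∀ i → 1 ≤ i → i < n → lam (suc i) ≤ lam i)
    (mu-antitone : ∀ i → 1 ≤ i → i < n → mu (suc i) ≤ mu i)
    (r≤s : ∀ i → 1 ≤ i → i ≤ n → r i ≤ s i)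
    (monotone-unless-cut : ∀ i → 1 ≤ i → i < n → mu i < lam (suc i) →
                           r i ≤ r (suc i) × s i ≤ s (suc i)) where
  open CommutativeRing R hiding (zero)
  open Determinant R using (Matrix; ZeroBlock; AgreeOrOffDiagonal)
  open EntryVanishing R x α β using (e-negative; e-telescoping-vanishes)

  ent entχ : ℕ → ℕ → Carrier
  ent = entry R x α β lam mu r s
  entχ = entryχ R x α β lam mu r s

  M Mχ : Matrix n
  M i j = ent (suc (toℕ i)) (suc (toℕ j))
  Mχ i j = entχ (suc (toℕ i)) (suc (toℕ j))

  -- The skew diagram λ/μ falls apart between rows k and k + 1.
  Cut : ℕ → Set
  Cut k = lam (suc k) ≤ mu k

  entryχ-cases : ∀ I J → entχ I J ≈ ent I J ⊎ (s I < r J × entχ I J ≈ 0#)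
  entryχ-cases I J with r J ≤ᵇ s I | ≤ᵇ-reflects-≤ (r J) (s I)
  ... | true | ofʸ _ = inj₁ refl
  ... | false | ofⁿ rJ≰sI = inj₂ (≰⇒> rJ≰sI , refl)

  entryχ-vanishes : ∀ {I J} → ent I J ≈ 0# → entχ I J ≈ 0#
  entryχ-vanishes {I} {J} ent≈0 with entryχ-cases I J
  ... | inj₁ χ≈ = trans χ≈ ent≈0
  ... | inj₂ (_ , χ≈0) = χ≈0

  entry-vanishes-below-cut : ∀ {k A B} → Cut k → 1 ≤ B → B ≤ k → k < A → A ≤ n → ent A B ≈ 0#
  entry-vanishes-below-cut {k} {A} {B} cut 1≤B B≤k k<A A≤n =
    e-negative _ (degree-negative {lam A} {mu B} {A} {B} (+-mono-≤-< lamA≤muB (≤-<-trans B≤k k<A)))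
    where
    open ≤-Reasoning
    lamA≤muB : lam A ≤ mu B
    lamA≤muB = begin
      lam A        ≤⟨ stepwise-antitone lam lam-antitone (s≤s z≤n) k<A A≤n ⟩
      lam (suc k)  ≤⟨ cut ⟩
      mu k         ≤⟨ stepwise-antitone mu mu-antitone 1≤B B≤k (≤-trans (<⇒≤ k<A) A≤n) ⟩
      mu B         ∎

  entry-vanishes-above-diagonal : ∀ {i j} → i < j → suc j ≤ n → ¬ Cut j → s (suc i) < r (suc j) →
                                  ent (suc i) (suc j) ≈ 0#
  entry-vanishes-above-diagonal {i} {j} i<j j<n noCut sI<rJ =
    e-telescoping-vanishes (<⇒≤ i<j) muJ<lamI sI<rJ
    where
    open ≤-Reasoning
    muJ<lamI : mu (suc j) < lam (suc i)
    muJ<lamI = begin-strict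
      mu (suc j)   ≤⟨ mu-antitone j (≤-trans (s≤s z≤n) i<j) j<n ⟩
      mu j         <⟨ ≰⇒> noCut ⟩
      lam (suc j)  ≤⟨ stepwise-antitone lam lam-antitone (s≤s z≤n) (s≤s (<⇒≤ i<j)) j<n ⟩
      lam (suc i)  ∎

  cut-zeroBlocks : ∀ {k} → Cut k → ZeroBlock Mχ k k × ZeroBlock M k k
  cut-zeroBlocks {k} cut = (λ a b k≤a b<k → entryχ-vanishes (below a b k≤a b<k)) , below
    where
    below : ZeroBlock M k k
    below a b k≤a b<k = entry-vanishes-below-cut cut (s≤s z≤n) b<k (s≤s k≤a) (toℕ<n a)

  r-monotone-or-cut : ∀ {a b} → 1 ≤ a → a ≤ b → b ≤ n → r a ≤ r b ⊎ ∃[ k ] (a ≤ k × k < b × Cut k)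
  r-monotone-or-cut {a} 1≤a a≤b = go (≤⇒≤′ a≤b)
    where
    go : ∀ {b} → a ≤′ b → b ≤ n → r a ≤ r b ⊎ ∃[ k ] (a ≤ k × k < b × Cut k)
    go ≤′-refl _ = inj₁ ≤-refl
    go (≤′-step {b} a≤′b) b<n with go a≤′b (<⇒≤ b<n) | mu b <? lam (suc b)
    ... | inj₂ (k , a≤k , k<b , cut) | _ = inj₂ (k , a≤k , m<n⇒m<1+n k<b , cut)
    ... | inj₁ ra≤rb | yes noCut =
          inj₁ (≤-trans ra≤rb (proj₁ (monotone-unless-cut b (≤-trans 1≤a (≤′⇒≤ a≤′b)) b<n noCut)))
    ... | inj₁ _ | no cut = inj₂ (b , ≤′⇒≤ a≤′b , ≤-refl , ≮⇒≥ cut)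

  agreeOrOffDiagonal : ∀ i j → AgreeOrOffDiagonal Mχ M i j
  agreeOrOffDiagonal i j with entryχ-cases (suc (toℕ i)) (suc (toℕ j))
  ... | inj₁ χ≈ = inj₁ χ≈
  ... | inj₂ (sI<rJ , χ≈0) with <-cmp (toℕ i) (toℕ j)
  ...   | tri≈ _ i≡j _ =
          ⊥-elim (<⇒≱ sI<rJ
            (≡.subst (λ t → r (suc t) ≤ s (suc (toℕ i))) i≡j (r≤s _ (s≤s z≤n) (toℕ<n i))))
  ...   | tri< i<j _ _ with lam (suc (toℕ j)) ≤? mu (toℕ j)
  ...     | yes cut = inj₂ (toℕ j , i<j , ≤-refl , cut-zeroBlocks cut)
  ...     | no noCut = inj₁ (trans χ≈0 (sym (entry-vanishes-above-diagonal i<j (toℕ<n j) noCut sI<rJ)))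
  agreeOrOffDiagonal i j | inj₂ (sI<rJ , χ≈0) | tri> _ _ j<i
    with r-monotone-or-cut (s≤s z≤n) (s≤s (<⇒≤ j<i)) (toℕ<n i)
  ...     | inj₁ rJ≤rI = ⊥-elim (<⇒≱ sI<rJ (≤-trans rJ≤rI (r≤s _ (s≤s z≤n) (toℕ<n i))))
  ...     | inj₂ (k , J≤k , k<I , cut) =
          inj₁ (trans χ≈0 (sym (entry-vanishes-below-cut cut (s≤s z≤n) J≤k k<I (toℕ<n i))))

lemma4p19 : ∀ {c ℓ : Level} (R : CommutativeRing c ℓ)
    (x α β : ℕ → CommutativeRing.Carrier R)
    (n : ℕ) (lam mu r s : ℕ → ℕ) →
    (∀ i → 1 ≤ i → i < n → lam (suc i) ≤ lam i) →
    (∀ i → 1 ≤ i → i < n → mu (suc i) ≤ mu i) →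
    (∀ i → 1 ≤ i → i ≤ n → mu i ≤ lam i) →
    (∀ i → 1 ≤ i → i ≤ n → 1 ≤ r i) →
    (∀ i → 1 ≤ i → i ≤ n → r i ≤ s i) →
    (∀ i → 1 ≤ i → i < n → mu i < lam (suc i) → r i ≤ r (suc i) × s i ≤ s (suc i)) →
    CommutativeRing._≈_ R
      (det R n (λ i j → entryχ R x α β lam mu r s (suc (toℕ i)) (suc (toℕ j))))
      (det R n (λ i j → entry R x α β lam mu r s (suc (toℕ i)) (suc (toℕ j))))
lemma4p19 R x α β n lam mu r s lam-stepwise-antitone mu-antitone _ _ r≤s monotone-unless-cut =
  Determinant.det-cong-offDiagonal R
    (Entries.agreeOrOffDiagonal R x α β n lam mu r s lam-stepwise-antitone mu-antitone r≤s monotone-unless-cut)
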